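{- Let the maps $\tau^{(n)}$ be as defined in the context. For all $n\ge i\ge1$ and all $(v_1,\dots,v_n)\in\{0,1,2\}^n$, the $i$-th coordinate of $\tau^{(n)}(v_1,\dots,v_n)$ equals the $i$-th coordinate of $\tau^{(i)}(v_1,\dots,v_i)$.
   Context: Define maps $\tau^{(n)}:\{0,1,2\}^n\to\{0,1,2\}^n$ recursively: $\tau^{(1)}$ is the identity, and for $n\ge2$, $\tau^{(n)}(v_1,\dots,v_n)=\bigl(v_1,\ \tau^{(n-1)}(2(v_1+v_2)\bmod 3,\ 2(v_1+v_3)\bmod 3,\dots,2(v_1+v_n)\bmod 3)\bigr)$. (This map carries the Sierpinski graph $S(n,3)$ onto the Tower of Hanoi graph with 3 pegs and $n$ discs.) -}

module Defs where

open import Data.Nat using (ℕ; zero; suc)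
open import Data.Fin using (Fin; zero; suc)
open import Data.Vec using (Vec; []; _∷_; map)

add3 : Fin 3 → Fin 3 → Fin 3
add3 zero y = y
add3 (suc zero) zero = suc zero
add3 (suc zero) (suc zero) = suc (suc zero)
add3 (suc zero) (suc (suc zero)) = zero
add3 (suc (suc zero)) zero = suc (suc zero)
add3 (suc (suc zero)) (suc zero) = zero
add3 (suc (suc zero)) (suc (suc zero)) = suc zero

double3 : Fin 3 → Fin 3
double3 x = add3 x x

-- The map τ⁽ⁿ⁾ : {0,1,2}ⁿ → {0,1,2}ⁿ (defined for n ≥ 1; τ⁽⁰⁾ is the
-- trivial map on the empty vector, only present for totality).
τ : (n : ℕ) → Vec (Fin 3) n → Vec (Fin 3) n
τ zero [] = []
τ (suc zero) (v ∷ []) = v ∷ []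
τ (suc (suc n)) (v₁ ∷ rest) =
  v₁ ∷ τ (suc n) (map (λ w → double3 (add3 v₁ w)) rest)

module Submission where

open import Defs
open import Data.Nat using (ℕ; zero; suc; _+_)
open import Data.Fin using (Fin; fromℕ; _↑ˡ_; zero; suc)
open import Data.Vec using (Vec; lookup; take; _∷_; []; map)
open import Data.Vec.Properties using (take-map)
open import Relation.Binary.PropositionalEquality using (_≡_; refl; cong)
open Relation.Binary.PropositionalEquality.≡-Reasoning

-- Each τ step keeps the first coordinate and transforms every later one
-- pointwise, so the first k coordinates of the image depend only on the
-- first k coordinates of the input: τ commutes with truncation.

lookup-↑ˡ≡lookup-take : ∀ {A : Set} k m (xs : Vec A (k + m)) (i : Fin k) →
                        lookup xs (i ↑ˡ m) ≡ lookup (take k xs) i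
lookup-↑ˡ≡lookup-take (suc k) m (x ∷ xs) zero    = refl
lookup-↑ˡ≡lookup-take (suc k) m (x ∷ xs) (suc i) = lookup-↑ˡ≡lookup-take k m xs i

take-τ : ∀ j m (v : Vec (Fin 3) (suc j + m)) →
         take (suc j) (τ (suc j + m) v) ≡ τ (suc j) (take (suc j) v)
take-τ zero    zero    (x ∷ [])   = refl
take-τ zero    (suc m) (x ∷ rest) = refl
take-τ (suc j) m       (x ∷ rest) = cong (x ∷_) (begin
    take (suc j) (τ (suc j + m) (map step rest))
  ≡⟨ take-τ j m (map step rest) ⟩
    τ (suc j) (take (suc j) (map step rest))
  ≡⟨ cong (τ (suc j)) (take-map step (suc j) rest) ⟩
    τ (suc j) (map step (take (suc j) rest))
  ∎)
  where
  step : Fin 3 → Fin 3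
  step w = double3 (add3 x w)

lemma3 : (j m : ℕ) (v : Vec (Fin 3) (suc j + m)) →
    lookup (τ (suc j + m) v) (fromℕ j ↑ˡ m)
    ≡ lookup (τ (suc j) (take (suc j) v)) (fromℕ j)
lemma3 j m v = begin
    lookup (τ (suc j + m) v) (fromℕ j ↑ˡ m)
  ≡⟨ lookup-↑ˡ≡lookup-take (suc j) m (τ (suc j + m) v) (fromℕ j) ⟩
    lookup (take (suc j) (τ (suc j + m) v)) (fromℕ j)
  ≡⟨ cong (λ w → lookup w (fromℕ j)) (take-τ j m v) ⟩
    lookup (τ (suc j) (take (suc j) v)) (fromℕ j)
  ∎
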